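{- Let $b\ge 2$ be even. Then there exist infinitely many positive integers that are additive multipliers (in base $b$) of some $b$-ARH number. Moreover, there exist infinitely many $b$-ARH numbers that have at least two distinct additive multipliers.
   Context: For a positive integer $N$, $s_b(N)$ is the sum of the base-$b$ digits of $N$, and the reversal $N^R$ is the integer obtained by writing the base-$b$ digits of $N$ in reverse order. A positive integer $N$ is a $b$-ARH number if there exists a positive integer $M$ (called an additive multiplier of $N$) such that $N=Ms_b(N)+(Ms_b(N))^R$. -}

module Defs where

open import Data.Nat using (ℕ; zero; suc; _+_; _*_; _<_; _≤_; NonZero)
open import Data.Nat.DivMod using (_/_; _%_)
open import Data.List using (List; []; _∷_; foldl)
open import Data.Nat.ListAction using (sum)
open import Data.Product using (Σ; _×_; ∃)
open import Relation.Binary.PropositionalEquality using (_≡_; _≢_)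

-- Base-b digits of n, least significant first, computed with fuel.
-- For b ≥ 2 fuel n suffices (n has at most n digits); digits 0 = [].
digitsFuel : (b : ℕ) → .{{NonZero b}} → ℕ → ℕ → List ℕ
digitsFuel b zero    n       = []
digitsFuel b (suc f) zero    = []
digitsFuel b (suc f) (suc n) = (suc n % b) ∷ digitsFuel b f (suc n / b)

digits : (b : ℕ) → .{{NonZero b}} → ℕ → List ℕ
digits b n = digitsFuel b n n

digitSum : (b : ℕ) → .{{NonZero b}} → ℕ → ℕ
digitSum b n = sum (digits b n)

-- N^R: the integer whose base-b digits are those of N in reverse order.
-- Digits are stored least significant first, so reading them as most
-- significant first (Horner scheme) gives the reversal.
reversal : (b : ℕ) → .{{NonZero b}} → ℕ → ℕ
reversal b n = foldl (λ acc d → acc * b + d) 0 (digits b n)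

IsAdditiveMultiplier : (b : ℕ) → .{{NonZero b}} → ℕ → ℕ → Set
IsAdditiveMultiplier b M N =
  0 < N × 0 < M × N ≡ M * digitSum b N + reversal b (M * digitSum b N)

IsARH : (b : ℕ) → .{{NonZero b}} → ℕ → Set
IsARH b N = 0 < N × ∃ λ M → IsAdditiveMultiplier b M N

module Submission where

-- Write b = 2k and call  spike m = 1 + b^(m+1)  (base-b digits
-- 1 0…0 1 with m inner zeros).  A spike is a palindrome, and reversal ignores
-- trailing zeros, so  (spike i · b^p)^R = spike i.  Hence
--     spike i · b^(j+1) + (spike i · b^(j+1))^R = spike i · spike j ,
-- and the product is split in two ways, by shifting either factor.  For
-- N = spike 1 · spike (n+2) = 1 + b² + b^(n+3) + b^(n+5) the digit sum is 4,
-- and since 4k² = b² every shifted spike spike i · b^(q+2) equals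
-- (k² · spike i · b^q) · 4.  So M = k²·spike 1·b^(n+1) and M' = k²·spike (n+2)
-- are two distinct additive multipliers of N, and M' > n.

open import Defs
open import Data.Nat using (ℕ; zero; suc; _+_; _*_; _^_; _<_; _≤_; NonZero; z<s)
open import Data.Nat.Properties
open import Data.Nat.DivMod using (_/_; _%_; [m+kn]%n≡m%n; m<n⇒m%n≡m; +-distrib-/-∣ʳ; m<n⇒m/n≡0; m*n/n≡m)
open import Data.Nat.Divisibility using (divides-refl)
open import Data.Nat.ListAction using (sum)
open import Data.Nat.ListAction.Properties using (sum-++)
open import Data.List using (List; []; _∷_; _++_; [_]; replicate; foldl)
open import Data.Product using (∃; _×_; _,_; proj₁)
open import Relation.Binary.PropositionalEquality using (_≡_; _≢_; refl; sym; trans; cong; cong₂; subst; module ≡-Reasoning)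
open import Data.Nat.Tactic.RingSolver using (solve-∀)

val : ℕ → List ℕ → ℕ
val b []       = 0
val b (d ∷ ds) = d + val b ds * b

-- ds is the base-b expansion of a number: all entries are digits and there is
-- no leading zero, i.e. every nonempty suffix has positive value.
data Canonical (b : ℕ) : List ℕ → Set where
  []   : Canonical b []
  cons : ∀ {d ds} → d < b → Canonical b ds → 0 < val b (d ∷ ds) → Canonical b (d ∷ ds)

module Base (b : ℕ) .{{_ : NonZero b}} (1<b : 1 < b) where

  0<b : 0 < b
  0<b = <-trans z<s 1<b

  n<b^n : ∀ n → n < b ^ n
  n<b^n zero    = z<s
  n<b^n (suc n) = begin-strict
    suc n      ≤⟨ n<b^n n ⟩
    b ^ n      <⟨ m<m*n (b ^ n) b {{m^n≢0 b n}} 1<b ⟩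
    b ^ n * b  ≡⟨ *-comm (b ^ n) b ⟩
    b ^ suc n  ∎
    where open ≤-Reasoning

  digitsFuel-step : ∀ f d q → d < b → 0 < d + q * b →
                    digitsFuel b (suc f) (d + q * b) ≡ d ∷ digitsFuel b f q
  digitsFuel-step f d q d<b pos with d + q * b in eq
  ... | suc x = cong₂ _∷_ last-digit (cong (digitsFuel b f) quotient)
    where
    last-digit : suc x % b ≡ d
    last-digit = trans (cong (_% b) (sym eq)) (trans ([m+kn]%n≡m%n d q b) (m<n⇒m%n≡m d<b))
    quotient : suc x / b ≡ q
    quotient = begin
      suc x / b             ≡⟨ cong (_/ b) (sym eq) ⟩
      (d + q * b) / b       ≡⟨ +-distrib-/-∣ʳ d (divides-refl q) ⟩
      d / b + q * b / b     ≡⟨ cong₂ _+_ (m<n⇒m/n≡0 d<b) (m*n/n≡m q b) ⟩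
      q                     ∎
      where open ≡-Reasoning

  -- The quotient is strictly smaller, so the fuel n suffices for digits n.
  quotient-smaller : ∀ d q → 0 < d + q * b → q < d + q * b
  quotient-smaller d zero    pos = pos
  quotient-smaller d (suc q) _   = ≤-trans (m<m*n (suc q) b 1<b) (m≤n+m (suc q * b) d)

  digitsFuel-val : ∀ {ds} → Canonical b ds → ∀ f → val b ds ≤ f → digitsFuel b f (val b ds) ≡ ds
  digitsFuel-val []                 zero    _  = refl
  digitsFuel-val []                 (suc f) _  = refl
  digitsFuel-val (cons _ _ pos)     zero    le with () ← ≤-trans pos le
  digitsFuel-val {d ∷ ds} (cons d<b c pos) (suc f) le =
    trans (digitsFuel-step f d (val b ds) d<b pos)
      (cong (d ∷_) (digitsFuel-val c f (≤-pred (≤-trans (quotient-smaller d (val b ds) pos) le))))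

  digits-val : ∀ {ds} → Canonical b ds → digits b (val b ds) ≡ ds
  digits-val {ds} c = digitsFuel-val c (val b ds) ≤-refl

  digitSum-val : ∀ {ds} → Canonical b ds → digitSum b (val b ds) ≡ sum ds
  digitSum-val c = cong sum (digits-val c)

  horner : ℕ → List ℕ → ℕ
  horner a ds = foldl (λ acc d → acc * b + d) a ds

  reversal-val : ∀ {ds} → Canonical b ds → reversal b (val b ds) ≡ horner 0 ds
  reversal-val c = cong (horner 0) (digits-val c)

  zeros : ℕ → List ℕ
  zeros p = replicate p 0

  val-shift : ∀ p ys → val b (zeros p ++ ys) ≡ val b ys * b ^ p
  val-shift zero    ys = sym (*-identityʳ _)
  val-shift (suc p) ys = begin
    val b (zeros p ++ ys) * b  ≡⟨ cong (_* b) (val-shift p ys) ⟩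
    val b ys * b ^ p * b       ≡⟨ *-assoc (val b ys) (b ^ p) b ⟩
    val b ys * (b ^ p * b)     ≡⟨ cong (val b ys *_) (*-comm (b ^ p) b) ⟩
    val b ys * b ^ suc p       ∎
    where open ≡-Reasoning

  prepend : ∀ {d ds} → d < b → Canonical b ds → 0 < val b ds → Canonical b (d ∷ ds)
  prepend {d} {ds} d<b c pos = cons d<b c (≤-trans (*-mono-< pos 1<b) (m≤n+m (val b ds * b) d))

  val-shift-positive : ∀ p {ys} → 0 < val b ys → 0 < val b (zeros p ++ ys)
  val-shift-positive p {ys} pos = subst (0 <_) (sym (val-shift p ys)) (*-mono-≤ pos (m^n>0 b p))

  canonical-shift : ∀ p {ys} → Canonical b ys → 0 < val b ys → Canonical b (zeros p ++ ys)
  canonical-shift zero    c _   = c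
  canonical-shift (suc p) c pos = prepend 0<b (canonical-shift p c pos) (val-shift-positive p pos)

  horner-shift : ∀ a p ys → horner a (zeros p ++ ys) ≡ horner (a * b ^ p) ys
  horner-shift a zero    ys = cong (λ z → horner z ys) (sym (*-identityʳ a))
  horner-shift a (suc p) ys = trans (horner-shift (a * b + 0) p ys)
    (cong (λ z → horner z ys) (trans (cong (_* b ^ p) (+-identityʳ (a * b))) (*-assoc a b (b ^ p))))

  reversal-shift : ∀ p {ys} → Canonical b ys → 0 < val b ys →
                   reversal b (val b ys * b ^ p) ≡ reversal b (val b ys)
  reversal-shift p {ys} c pos = begin
    reversal b (val b ys * b ^ p)        ≡⟨ cong (reversal b) (sym (val-shift p ys)) ⟩
    reversal b (val b (zeros p ++ ys))   ≡⟨ reversal-val (canonical-shift p c pos) ⟩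
    horner 0 (zeros p ++ ys)             ≡⟨ horner-shift 0 p ys ⟩
    horner 0 ys                          ≡⟨ reversal-val c ⟨
    reversal b (val b ys)                ∎
    where open ≡-Reasoning

  spike : ℕ → ℕ
  spike m = 1 + b ^ suc m

  spike-digits : ℕ → List ℕ
  spike-digits m = 1 ∷ zeros m ++ [ 1 ]

  val-spike : ∀ m → val b (spike-digits m) ≡ spike m
  val-spike m = trans (cong (λ z → 1 + z * b) (trans (val-shift m [ 1 ]) (*-identityˡ (b ^ m))))
    (cong (1 +_) (*-comm (b ^ m) b))

  canonical-one : Canonical b [ 1 ]
  canonical-one = cons 1<b [] z<s

  canonical-spike : ∀ m → Canonical b (spike-digits m)
  canonical-spike m = prepend 1<b (canonical-shift m canonical-one z<s) (val-shift-positive m z<s)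

  reversal-spike : ∀ m → reversal b (spike m) ≡ spike m
  reversal-spike m = begin
    reversal b (spike m)                   ≡⟨ cong (reversal b) (sym (val-spike m)) ⟩
    reversal b (val b (spike-digits m))    ≡⟨ reversal-val (canonical-spike m) ⟩
    horner 0 (spike-digits m)              ≡⟨ horner-shift 1 m [ 1 ] ⟩
    1 * b ^ m * b + 1                      ≡⟨ cong (λ z → z * b + 1) (*-identityˡ (b ^ m)) ⟩
    b ^ m * b + 1                          ≡⟨ +-comm (b ^ m * b) 1 ⟩
    1 + b ^ m * b                          ≡⟨ cong (1 +_) (*-comm (b ^ m) b) ⟩
    spike m                                ∎
    where open ≡-Reasoning

  spike-shift-split : ∀ i j → spike i * b ^ suc j + reversal b (spike i * b ^ suc j) ≡ spike i * spike j
  spike-shift-split i j = begin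
    spike i * b ^ suc j + reversal b (spike i * b ^ suc j)
      ≡⟨ cong (λ x → spike i * b ^ suc j + reversal b (x * b ^ suc j)) (sym (val-spike i)) ⟩
    spike i * b ^ suc j + reversal b (val b (spike-digits i) * b ^ suc j)
      ≡⟨ cong (spike i * b ^ suc j +_) (reversal-shift (suc j) (canonical-spike i) z<s) ⟩
    spike i * b ^ suc j + reversal b (val b (spike-digits i))
      ≡⟨ cong (λ x → spike i * b ^ suc j + reversal b x) (val-spike i) ⟩
    spike i * b ^ suc j + reversal b (spike i)
      ≡⟨ cong (spike i * b ^ suc j +_) (reversal-spike i) ⟩
    spike i * b ^ suc j + spike i
      ≡⟨ factor (spike i) (b ^ suc j) ⟩
    spike i * spike j  ∎
    where
    open ≡-Reasoning
    factor : ∀ x y → x * y + x ≡ x * (1 + y)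
    factor = solve-∀

  below-spike : ∀ m → m < spike m
  below-spike m = m≤n⇒m≤1+n (<-trans (n<1+n m) (n<b^n (suc m)))

  -- The two ways of splitting N are really different: b^(n+1) ≠ 1.
  shifted-spikes-differ : ∀ n → spike 1 * b ^ suc n ≢ spike (suc (suc n)) * b ^ 0
  shifted-spikes-differ n eq = <-irrefl refl (subst (1 <_) b≡1 1<b)
    where
    P = b ^ n
    expand₁ : ∀ b P → (1 + b * (b * 1)) * (b * P) ≡ b * P + b * (b * (b * P))
    expand₁ = solve-∀
    expand₂ : ∀ b P → (1 + b * (b * (b * P))) * 1 ≡ 1 + b * (b * (b * P))
    expand₂ = solve-∀
    b≡1 : b ≡ 1
    b≡1 = m*n≡1⇒m≡1 b P (+-cancelʳ-≡ (b * (b * (b * P))) (b * P) 1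
            (trans (sym (expand₁ b P)) (trans eq (expand₂ b P))))

  two-spikes-digits : ℕ → List ℕ
  two-spikes-digits n = spike-digits 1 ++ zeros n ++ spike-digits 1

  canonical-two-spikes : ∀ n → Canonical b (two-spikes-digits n)
  canonical-two-spikes n =
    cons 1<b (prepend 0<b (prepend 1<b shifted (val-shift-positive n z<s)) z<s) z<s
    where
    shifted : Canonical b (zeros n ++ spike-digits 1)
    shifted = canonical-shift n (canonical-spike 1) z<s

  val-two-spikes : ∀ n → val b (two-spikes-digits n) ≡ spike 1 * spike (suc (suc n))
  val-two-spikes n = begin
    val b (two-spikes-digits n)
      ≡⟨ cong (λ z → 1 + (0 + (1 + z * b) * b) * b) (val-shift n (spike-digits 1)) ⟩
    1 + (0 + (1 + val b (spike-digits 1) * b ^ n * b) * b) * b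
      ≡⟨ cong (λ z → 1 + (0 + (1 + z * b ^ n * b) * b) * b) (val-spike 1) ⟩
    1 + (0 + (1 + spike 1 * b ^ n * b) * b) * b
      ≡⟨ factor b (b ^ n) ⟩
    spike 1 * spike (suc (suc n))  ∎
    where
    open ≡-Reasoning
    factor : ∀ b P → 1 + (0 + (1 + (1 + b * (b * 1)) * P * b) * b) * b
                     ≡ (1 + b * (b * 1)) * (1 + b * (b * (b * P)))
    factor = solve-∀

  digitSum-two-spikes : ∀ n → digitSum b (spike 1 * spike (suc (suc n))) ≡ 4
  digitSum-two-spikes n = begin
    digitSum b (spike 1 * spike (suc (suc n)))     ≡⟨ cong (digitSum b) (sym (val-two-spikes n)) ⟩
    digitSum b (val b (two-spikes-digits n))       ≡⟨ digitSum-val (canonical-two-spikes n) ⟩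
    2 + sum (zeros n ++ spike-digits 1)            ≡⟨ cong (2 +_) (sum-++ (zeros n) (spike-digits 1)) ⟩
    2 + (sum (zeros n) + 2)                        ≡⟨ cong (λ z → 2 + (z + 2)) (sum-zeros n) ⟩
    4                                              ∎
    where
    open ≡-Reasoning
    sum-zeros : ∀ p → sum (zeros p) ≡ 0
    sum-zeros zero    = refl
    sum-zeros (suc p) = sum-zeros p

  module Even (k : ℕ) .{{_ : NonZero k}} (b≡2k : b ≡ 2 * k) where

    multiplier : ℕ → ℕ → ℕ
    multiplier i q = k * k * spike i * b ^ q

    multiplier-times-4 : ∀ i q → multiplier i q * 4 ≡ spike i * b ^ suc (suc q)
    multiplier-times-4 i q =
      subst (λ c → k * k * spike i * c ^ q * 4 ≡ spike i * (c * (c * c ^ q))) (sym b≡2k)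
        (quarter-square k (spike i) ((2 * k) ^ q))
      where
      quarter-square : ∀ k x P → k * k * x * P * 4 ≡ x * (2 * k * (2 * k * P))
      quarter-square = solve-∀

    spike-below-multiplier : ∀ i q → spike i ≤ multiplier i q
    spike-below-multiplier i q =
      ≤-trans (m≤n*m (spike i) (k * k) {{m*n≢0 k k}}) (m≤m*n (k * k * spike i) (b ^ q) {{m^n≢0 b q}})

    multipliers-differ : ∀ n → multiplier 1 (suc n) ≢ multiplier (suc (suc n)) 0
    multipliers-differ n eq = shifted-spikes-differ n (*-cancelˡ-≡ _ _ (k * k) {{m*n≢0 k k}}
      (trans (sym (*-assoc (k * k) (spike 1) (b ^ suc n)))
        (trans eq (*-assoc (k * k) (spike (suc (suc n))) (b ^ 0)))))

    spike-multiplier : ∀ i q → digitSum b (spike i * spike (suc q)) ≡ 4 →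
                       IsAdditiveMultiplier b (multiplier i q) (spike i * spike (suc q))
    spike-multiplier i q digit-sum =
      *-mono-≤ {1} {spike i} {1} z<s z<s , <-≤-trans z<s (spike-below-multiplier i q) , split
      where
      M = multiplier i q
      N = spike i * spike (suc q)
      split : N ≡ M * digitSum b N + reversal b (M * digitSum b N)
      split = begin
        N                                                       ≡⟨ spike-shift-split i (suc q) ⟨
        spike i * b ^ suc (suc q) + reversal b (spike i * b ^ suc (suc q))
                                                                ≡⟨ cong (λ y → y + reversal b y) (multiplier-times-4 i q) ⟨
        M * 4 + reversal b (M * 4)                              ≡⟨ cong (λ s → M * s + reversal b (M * s)) digit-sum ⟨
        M * digitSum b N + reversal b (M * digitSum b N)        ∎
        where open ≡-Reasoning

corollary17 : (b : ℕ) → .{{_ : NonZero b}} → 2 ≤ b → (∃ λ k → b ≡ 2 * k) →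
    ((n : ℕ) → ∃ λ M → n < M × ∃ λ N → IsAdditiveMultiplier b M N)
    × ((n : ℕ) → ∃ λ N → n < N × IsARH b N
        × ∃ λ M₁ → ∃ λ M₂ → M₁ ≢ M₂ × IsAdditiveMultiplier b M₁ N × IsAdditiveMultiplier b M₂ N)
corollary17 b 2≤b (zero , b≡0) with () ← ≤-trans 2≤b (≤-reflexive b≡0)
corollary17 b 2≤b (k@(suc _) , b≡2k) = large-multipliers , shared-numbers
  where
  open Base b 2≤b
  open Even k b≡2k

  module _ (n : ℕ) where
    N M₁ M₂ : ℕ
    N  = spike 1 * spike (suc (suc n))
    M₁ = multiplier 1 (suc n)
    M₂ = multiplier (suc (suc n)) 0

    is-M₁ : IsAdditiveMultiplier b M₁ N
    is-M₁ = spike-multiplier 1 (suc n) (digitSum-two-spikes n)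

    is-M₂ : IsAdditiveMultiplier b M₂ N
    is-M₂ = subst (IsAdditiveMultiplier b M₂) (*-comm (spike (suc (suc n))) (spike 1))
      (spike-multiplier (suc (suc n)) 0
        (trans (cong (digitSum b) (*-comm (spike (suc (suc n))) (spike 1))) (digitSum-two-spikes n)))

    n<spike : n < spike (suc (suc n))
    n<spike = ≤-trans (m≤n+m (suc n) 2) (below-spike (suc (suc n)))

  large-multipliers : (n : ℕ) → ∃ λ M → n < M × ∃ λ N → IsAdditiveMultiplier b M N
  large-multipliers n = M₂ n , <-≤-trans (n<spike n) (spike-below-multiplier (suc (suc n)) 0) , N n , is-M₂ n

  shared-numbers : (n : ℕ) → ∃ λ N → n < N × IsARH b N
    × ∃ λ M₁ → ∃ λ M₂ → M₁ ≢ M₂ × IsAdditiveMultiplier b M₁ N × IsAdditiveMultiplier b M₂ N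
  shared-numbers n =
    N n , <-≤-trans (n<spike n) (m≤n*m (spike (suc (suc n))) (spike 1)) , (proj₁ (is-M₁ n) , M₁ n , is-M₁ n) ,
    M₁ n , M₂ n , multipliers-differ n , is-M₁ n , is-M₂ n
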